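{- For all positive integers $j$ and $k$, $\{ n-(j+1) : n \in \mathbf{B}_{j+1}^k,\ n > j+1\} \subseteq \{ n-j : n \in \mathbf{B}_j^k,\ n > j\}.$
   Context: For positive integers $j,k$, a positive integer $n$ is called $(j,k)$-representable if $n = x_1^k + \cdots + x_j^k$ with all $x_i$ positive integers. $\mathbf{B}_j^k$ denotes the set of positive integers that are not $(j,k)$-representable. -}

module Defs where

open import Data.Nat using (ℕ; _^_; _≥_; _>_; _∸_)
import Data.Nat
open import Data.Fin using (Fin)
open import Data.Vec.Functional using (Vector)
open import Data.Vec.Functional as V using ()

open import Data.Product using (Σ; _×_)
open import Relation.Binary.PropositionalEquality using (_≡_)
open import Relation.Nullary using (¬_)

sumV : {j : ℕ} → Vector ℕ j → ℕ
sumV = V.foldr Data.Nat._+_ 0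

Representable : ℕ → ℕ → ℕ → Set
Representable j k n =
  Σ (Vector ℕ j) λ x → ((i : Fin j) → x i ≥ 1) × (n ≡ sumV (λ i → x i ^ k))

InB : ℕ → ℕ → ℕ → Set
InB j k n = n ≥ 1 × ¬ Representable j k n

InShiftedB : ℕ → ℕ → ℕ → Set
InShiftedB j k m = Σ ℕ λ n → InB j k n × n > j × m ≡ n ∸ j

module Submission where

open import Defs
open import Data.Nat using (ℕ; suc; _≥_; _+_; _^_; s≤s; z≤n)
open import Data.Nat.Properties using (^-zeroˡ; ≤-trans)
open import Data.Product using (_,_)
open import Data.Fin using (Fin; zero; suc)
open import Data.Vec.Functional using (_∷_)
open import Relation.Binary.PropositionalEquality using (_≡_; cong; sym; subst)
open import Relation.Nullary using (¬_)

-- Given n ∈ B_{j+1}^k with n > j + 1, a (j,k)-representation of n - 1 would extend by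
-- the summand 1 = 1^k to a (j+1,k)-representation of n; so n - 1 ∈ B_j^k, and
-- (n - 1) - j = n - (j + 1).

representable-suc : ∀ {j} k {n} → Representable j k n → Representable (suc j) k (suc n)
representable-suc {j} k {n} (x , x≥1 , n≡sum) = 1 ∷ x , 1∷x≥1 , suc-n≡sum
  where
  1∷x≥1 : (i : Fin (suc j)) → (1 ∷ x) i ≥ 1
  1∷x≥1 zero    = s≤s z≤n
  1∷x≥1 (suc i) = x≥1 i

  suc-n≡sum : suc n ≡ 1 ^ k + sumV (λ i → x i ^ k)
  suc-n≡sum = subst (λ one → suc n ≡ one + sumV (λ i → x i ^ k)) (sym (^-zeroˡ k)) (cong suc n≡sum)

not-representable-pred : ∀ {j} k {n} → ¬ Representable (suc j) k (suc n) → ¬ Representable j k n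
not-representable-pred k ¬rep rep = ¬rep (representable-suc k rep)

theorem10p9 : (j k : ℕ) → j ≥ 1 → k ≥ 1 → (m : ℕ) →
    InShiftedB (suc j) k m → InShiftedB j k m
theorem10p9 j k _ _ m (suc n , (_ , ¬rep) , s≤s n>j , m≡n∸j) =
  n , (n≥1 , not-representable-pred k ¬rep) , n>j , m≡n∸j
  where
  n≥1 : n ≥ 1
  n≥1 = ≤-trans (s≤s z≤n) n>j
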